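{- Let $D$ be a strongly connected balanced bipartite digraph of order $2a\geq 8$ with partite sets $X$ and $Y$ such that $\max\{d(x),d(y)\}\geq 2a-1$ for every dominating pair of vertices $\{x,y\}$. Then (i) the underlying graph $UG(D)$ is 2-connected; and (ii) if $C$ is a directed cycle in $D$ of length $m$ with $2\leq m\leq 2a-2$, then $D$ contains a $C$-bypass.
   Context: Digraphs are finite, without loops or multiple arcs (2-cycles allowed). $d(x)=d^+(x)+d^-(x)$. A pair of distinct vertices $\{x,y\}$ is dominating if there is a vertex $z$ with $x\to z$ and $y\to z$. $UG(D)$ is the undirected graph on $V(D)$ with an edge $xy$ whenever $x\to y$ or $y\to x$. For a nontrivial proper subset $H$ of vertices (here $H=V(C)$), an $H$-bypass is a directed $(x,y)$-path $P$ with at least 3 vertices, $x\neq y$, and $V(P)\cap H=\{x,y\}$. -}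

module Defs where

open import Data.Nat using (ℕ; zero; suc; _+_; _*_; _∸_; _≤_; _<_; _⊔_)
open import Data.Fin using (Fin; zero; suc; inject₁; fromℕ)
open import Data.Bool using (Bool; true; false; if_then_else_)
open import Data.Product using (Σ; ∃; ∃-syntax; _×_; _,_)
open import Data.Sum using (_⊎_)
open import Relation.Binary.PropositionalEquality using (_≡_; _≢_)
open import Relation.Binary.Construct.Closure.ReflexiveTransitive using (Star)
open import Function.Definitions using (Injective)

-- A digraph on vertex set Fin n: an arc relation given by a Bool-valued
-- adjacency function, with no loops.  (2-cycles are allowed; multiple arcs
-- are impossible by construction.)
record Digraph (n : ℕ) : Set where
  field
    arc      : Fin n → Fin n → Bool
    loopless : ∀ x → arc x x ≡ false

open Digraph public

_⟶[_]_ : ∀ {n} → Fin n → Digraph n → Fin n → Set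
x ⟶[ D ] y = arc D x y ≡ true

count : ∀ {n} → (Fin n → Bool) → ℕ
count {zero}  p = 0
count {suc n} p = (if p zero then 1 else 0) + count (λ i → p (suc i))

outdeg indeg deg : ∀ {n} → Digraph n → Fin n → ℕ
outdeg D x = count (λ y → arc D x y)
indeg  D x = count (λ y → arc D y x)
deg D x = outdeg D x + indeg D x

DominatingPair : ∀ {n} → Digraph n → Fin n → Fin n → Set
DominatingPair D x y = x ≢ y × ∃[ z ] (x ⟶[ D ] z × y ⟶[ D ] z)

StronglyConnected : ∀ {n} → Digraph n → Set
StronglyConnected D = ∀ x y → Star (λ u v → u ⟶[ D ] v) x y

BalancedBipartite : ∀ {n} → Digraph n → (side : Fin n → Bool) → ℕ → Set
BalancedBipartite D side a =
  (∀ x y → x ⟶[ D ] y → side x ≢ side y)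
  × count (λ v → if side v then false else true) ≡ a
  × count side ≡ a

UGEdge : ∀ {n} → Digraph n → Fin n → Fin n → Set
UGEdge D x y = x ⟶[ D ] y ⊎ y ⟶[ D ] x

TwoConnectedUG : ∀ {n} → Digraph n → Set
TwoConnectedUG {n} D =
  2 < n
  × (∀ x y → Star (UGEdge D) x y)
  × (∀ v x y → x ≢ v → y ≢ v →
       Star (λ u w → UGEdge D u w × u ≢ v × w ≢ v) x y)

record Cycle {n} (D : Digraph n) (m : ℕ) : Set where
  field
    len-1   : ℕ
    len≡    : m ≡ suc len-1
    vert    : Fin (suc len-1) → Fin n
    inj     : Injective _≡_ _≡_ vert
    step    : ∀ (i : Fin len-1) → vert (inject₁ i) ⟶[ D ] vert (suc i)
    close   : vert (fromℕ len-1) ⟶[ D ] vert zero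

open Cycle public

OnCycle : ∀ {n} {D : Digraph n} {m} → Cycle D m → Fin n → Set
OnCycle C v = ∃[ i ] vert C i ≡ v

record Path {n} (D : Digraph n) (k : ℕ) : Set where
  field
    pv    : Fin (suc k) → Fin n
    pinj  : Injective _≡_ _≡_ pv
    pstep : ∀ (i : Fin k) → pv (inject₁ i) ⟶[ D ] pv (suc i)

open Path public

-- A C-bypass: a directed (x,y)-path with at least 3 vertices, x ≠ y, whose
-- vertex set meets V(C) exactly in {x, y}.
Bypass : ∀ {n} {D : Digraph n} {m} → Cycle D m → Set
Bypass {n} {D} C =
  ∃[ l ] Σ (Path D (suc (suc l))) λ P →
    pv P zero ≢ pv P (fromℕ (suc (suc l)))
    × OnCycle C (pv P zero)
    × OnCycle C (pv P (fromℕ (suc (suc l))))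
    × (∀ (i : Fin (suc (suc (suc l)))) → OnCycle C (pv P i) →
         pv P i ≡ pv P zero ⊎ pv P i ≡ pv P (fromℕ (suc (suc l))))

-- (i) If UG(D) − v were disconnected, strong connectivity would give in-neighbours p, q of v in
-- different components of UG(D) − v. The pair {p, q} is dominating, say d(p) ≥ 2a − 1. Then p is
-- adjacent to the whole other side, so q has no neighbour but v. But p has two in-neighbours
-- besides v; they form a dominating pair, yet neither is adjacent to q, so both have degree
-- at most 2a − 2.
--
-- (ii) As m < 2a, some u lies off C, and a path from u reaches C first at some c. Walk in
-- UG(D) − c from u to a vertex of C other than c. Every off-cycle vertex w has paths from C to w
-- and from w to C through off-cycle vertices; if they can be taken at different vertices of C
-- they form a bypass, and otherwise the property "has such a path from or to c" passes on along
-- each edge of the walk, until the walk meets C at a vertex other than c and gives a bypass.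

module Submission where

open import Defs
open import Data.Nat using (ℕ; zero; suc; _+_; _∸_; _≤_; _<_; _⊔_; z≤n; s≤s)
open import Data.Nat.Properties
  using (≤-refl; ≤-reflexive; ≤-trans; n≤1+n; ≤-pred; <⇒≱; +-suc; +-mono-≤; +-monoˡ-≤; +-cancelˡ-≤;
         +-∸-assoc; ∸-monoˡ-≤; m∸n≤m; ⊔-sel)
open import Data.Bool using (Bool; true; false; if_then_else_)
open import Data.Bool.Properties using (¬-not) renaming (_≟_ to _≟ᴮ_)
open import Data.Fin using (Fin; zero; suc; _≟_; fromℕ; inject₁)
open import Data.Fin.Properties using (any?; suc-injective; injective⇒≤)
open import Data.Vec.Functional using (Vector; _∷_)
open import Data.Product using (∃; ∃₂; ∃-syntax; _×_; _,_; proj₁; proj₂)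
open import Data.Sum using (_⊎_; inj₁; inj₂; [_,_]′)
open import Data.Empty using (⊥-elim)
open import Function using (_∘_)
open import Function.Definitions using (Injective)
open import Level using (Level)
open import Relation.Nullary using (¬_; does; yes; no)
open import Relation.Nullary.Decidable using (map′; _×-dec_; _⊎-dec_; ¬?)
open import Relation.Unary using (Pred; ∁)
open import Relation.Binary.Core using (Rel)
open import Relation.Binary.Definitions using (Decidable; DecidableEquality)
open import Relation.Binary.PropositionalEquality
open import Relation.Binary.Construct.Closure.ReflexiveTransitive using (Star; ε; _◅_; _◅◅_)
  renaming (map to Star-map)

private
  variable
    n k : ℕ
    ℓ₁ ℓ₂ ℓ₃ : Level

-- Counting

_∖_ : (Fin n → Bool) → Fin n → (Fin n → Bool)
(p ∖ v) z = if does (z ≟ v) then false else p z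

∖-true : ∀ (p : Fin n → Bool) v z → (p ∖ v) z ≡ true → p z ≡ true × z ≢ v
∖-true p v z e with z ≟ v
... | no z≢v = e , z≢v

count-mono : ∀ (p q : Fin n → Bool) → (∀ i → p i ≡ true → q i ≡ true) → count p ≤ count q
count-mono {zero}  p q p⊆q = z≤n
count-mono {suc n} p q p⊆q with p zero in p₀ | q zero in q₀
... | true  | true  = s≤s (count-mono _ _ (p⊆q ∘ suc))
... | false | true  = ≤-trans (count-mono _ _ (p⊆q ∘ suc)) (n≤1+n _)
... | false | false = count-mono _ _ (p⊆q ∘ suc)
... | true  | false with () ← trans (sym (p⊆q zero p₀)) q₀

count-mono-< : ∀ (p q : Fin n → Bool) → (∀ i → p i ≡ true → q i ≡ true) →
               ∀ j → q j ≡ true → p j ≡ false → count p < count q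
count-mono-< p q p⊆q zero qj pj rewrite qj | pj = s≤s (count-mono _ _ (p⊆q ∘ suc))
count-mono-< p q p⊆q (suc j) qj pj with p zero in p₀ | q zero in q₀
... | true  | true  = s≤s (count-mono-< _ _ (p⊆q ∘ suc) j qj pj)
... | false | true  = ≤-trans (count-mono-< _ _ (p⊆q ∘ suc) j qj pj) (n≤1+n _)
... | false | false = count-mono-< _ _ (p⊆q ∘ suc) j qj pj
... | true  | false with () ← trans (sym (p⊆q zero p₀)) q₀

count-const : count {n} (λ _ → true) ≡ n
count-const {zero}  = refl
count-const {suc n} = cong suc count-const

count-pos : ∀ (p : Fin n → Bool) → 0 < count p → ∃[ z ] p z ≡ true
count-pos {suc n} p pos with p zero in p₀
... | true  = zero , p₀
... | false with z , pz ← count-pos (p ∘ suc) pos = suc z , pz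

count-∖ : ∀ (p : Fin n → Bool) v → count p ≤ suc (count (p ∖ v))
count-∖ {suc n} p zero with p zero
... | true  = ≤-refl
... | false = n≤1+n _
count-∖ {suc n} p (suc v) with p zero
... | true  = s≤s (count-∖ (p ∘ suc) v)
... | false = count-∖ (p ∘ suc) v

count-avoid : ∀ (p : Fin n → Bool) (f : Fin k → Fin n) → k < count p →
              ∃[ z ] p z ≡ true × (∀ i → f i ≢ z)
count-avoid {k = zero}  p f pos = let z , pz = count-pos p pos in z , pz , λ ()
count-avoid {k = suc k} p f k<p
  with z , p∖z , f∌z ← count-avoid (p ∖ f zero) (f ∘ suc) (≤-pred (≤-trans k<p (count-∖ p (f zero))))
  with pz , z≢f₀ ← ∖-true p (f zero) z p∖z
  = z , pz , λ { zero → z≢f₀ ∘ sym ; (suc i) → f∌z i }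

-- Walks

∷-injective : ∀ {A : Set ℓ₁} {x : A} {f : Vector A k} → (∀ i → f i ≢ x) → Injective _≡_ _≡_ f →
              Injective _≡_ _≡_ (x ∷ f)
∷-injective x∉f f-inj {zero}  {zero}  _ = refl
∷-injective x∉f f-inj {zero}  {suc j} e = ⊥-elim (x∉f j (sym e))
∷-injective x∉f f-inj {suc i} {zero}  e = ⊥-elim (x∉f i e)
∷-injective x∉f f-inj {suc i} {suc j} e = cong suc (f-inj e)

module _ {A : Set ℓ₁} {R : Rel A ℓ₂} where

  length : ∀ {x y} → Star R x y → ℕ
  length ε       = 0
  length (_ ◅ w) = suc (length w)

  vertex : ∀ {x y} (w : Star R x y) → Vector A (suc (length w))
  vertex {x} ε       _ = x
  vertex {x} (_ ◅ w)   = x ∷ vertex w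

  vertex-step : ∀ {x y} (w : Star R x y) (i : Fin (length w)) →
                R (vertex w (inject₁ i)) (vertex w (suc i))
  vertex-step (r ◅ ε)       zero    = r
  vertex-step (r ◅ (_ ◅ _)) zero    = r
  vertex-step (_ ◅ w)       (suc i) = vertex-step w i

  vertex-last : ∀ {x y} (w : Star R x y) → vertex w (fromℕ (length w)) ≡ y
  vertex-last ε       = refl
  vertex-last (_ ◅ w) = vertex-last w

  Simple : ∀ {x y} → Star R x y → Set ℓ₁
  Simple w = Injective _≡_ _≡_ (vertex w)

  suffix : ∀ {x y} (w : Star R x y) (i : Fin (suc (length w))) → Star R (vertex w i) y
  suffix ε       zero    = ε
  suffix (r ◅ w) zero    = r ◅ w
  suffix (_ ◅ w) (suc i) = suffix w i

  suffix-simple : ∀ {x y} (w : Star R x y) i → Simple w → Simple (suffix w i)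
  suffix-simple ε       zero    simple = simple
  suffix-simple (_ ◅ w) zero    simple = simple
  suffix-simple (_ ◅ w) (suc i) simple = suffix-simple w i (suc-injective ∘ simple)

  module _ (_≟ᴬ_ : DecidableEquality A) where

    simplify : ∀ {x y} → Star R x y → ∃[ w ] Simple {x} {y} w
    simplify ε = ε , λ { {zero} {zero} _ → refl }
    simplify {x} (r ◅ w) with w′ , simple ← simplify w | any? (λ i → vertex w′ i ≟ᴬ x)
    ... | yes (i , refl) = suffix w′ i , suffix-simple w′ i simple
    ... | no x∉w′        = r ◅ w′ , ∷-injective (λ i → x∉w′ ∘ (i ,_)) simple

module _ {R : Rel (Fin n) ℓ₁} (R? : Decidable R) where

  ShortWalk : ℕ → Rel (Fin n) ℓ₁
  ShortWalk k x y = ∃[ w ] length {R = R} {x} {y} w ≤ k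

  shortWalk? : ∀ k → Decidable (ShortWalk k)
  shortWalk? zero x y =
    map′ (λ { refl → ε , z≤n }) (λ { (ε , _) → refl ; (_ ◅ _ , ()) }) (x ≟ y)
  shortWalk? (suc k) x y =
    map′ from to (x ≟ y ⊎-dec any? (λ z → R? x z ×-dec shortWalk? k z y))
    where
      from : x ≡ y ⊎ ∃[ z ] R x z × ShortWalk k z y → ShortWalk (suc k) x y
      from (inj₁ refl)              = ε , z≤n
      from (inj₂ (_ , r , w , |w|≤k)) = r ◅ w , s≤s |w|≤k
      to : ShortWalk (suc k) x y → x ≡ y ⊎ ∃[ z ] R x z × ShortWalk k z y
      to (ε , _)             = inj₁ refl
      to (r ◅ w , s≤s |w|≤k) = inj₂ (_ , r , w , |w|≤k)

  -- A simple walk has at most n vertices, so it suffices to search walks of length at most n.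
  Star? : Decidable (Star R)
  Star? x y = map′ proj₁ shorten (shortWalk? n x y)
    where
      shorten : Star R x y → ShortWalk n x y
      shorten w with w′ , simple ← simplify _≟_ w = w′ , ≤-trans (n≤1+n _) (injective⇒≤ simple)

Through : {A : Set ℓ₁} → Pred A ℓ₂ → Rel A ℓ₃ → Rel A _
Through Q R u v = R u v × Q u

module _ {A : Set ℓ₁} {R : Rel A ℓ₂} {Q : Pred A ℓ₃} where

  through-source : ∀ {x y} → Star (Through Q R) x y → Q y → Q x
  through-source ε             Qy = Qy
  through-source ((_ , Qx) ◅ _) _ = Qx

  through-vertex : ∀ {x y} (w : Star (Through Q R) x y) i → vertex w i ≡ y ⊎ Q (vertex w i)
  through-vertex ε              zero    = inj₁ refl
  through-vertex ((_ , Qx) ◅ _) zero    = inj₂ Qx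
  through-vertex (_ ◅ w)        (suc i) = through-vertex w i

module _ {A : Set ℓ₁} {R : Rel A ℓ₂} {P : Pred A ℓ₃} (P? : Relation.Unary.Decidable P) where

  firstHit : ∀ {x y} → ¬ P x → P y → Star R x y → ∃[ c ] P c × Star (Through (∁ P) R) x c
  firstHit ¬Px Py ε = ⊥-elim (¬Px Py)
  firstHit {x} ¬Px Py (_◅_ {j = z} r w) with P? z
  ... | yes Pz = z , Pz , (r , ¬Px) ◅ ε
  ... | no ¬Pz with c , Pc , w′ ← firstHit ¬Pz Py w = c , Pc , (r , ¬Px) ◅ w′

  avoidOrDepart : ∀ {x y} → ¬ P y → Star R x y →
                  Star (Through (∁ P) R) x y ⊎ ∃₂ λ c s → P c × R c s × Star (Through (∁ P) R) s y
  avoidOrDepart ¬Py ε = inj₁ ε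
  avoidOrDepart {x} ¬Py (r ◅ w) with avoidOrDepart ¬Py w | P? x
  ... | inj₂ d  | _      = inj₂ d
  ... | inj₁ w′ | yes Px = inj₂ (x , _ , Px , r , w′)
  ... | inj₁ w′ | no ¬Px = inj₁ ((r , ¬Px) ◅ w′)

  lastDeparture : ∀ {x y} → P x → ¬ P y → Star R x y →
                  ∃₂ λ c s → P c × R c s × Star (Through (∁ P) R) s y
  lastDeparture Px ¬Py w with avoidOrDepart ¬Py w
  ... | inj₁ w′ = ⊥-elim (through-source w′ ¬Py Px)
  ... | inj₂ d  = d

UGEdge? : (D : Digraph n) → Decidable (UGEdge D)
UGEdge? D u w = (arc D u w ≟ᴮ true) ⊎-dec (arc D w u ≟ᴮ true)

UGEdge-sym : ∀ (D : Digraph n) {u w} → UGEdge D u w → UGEdge D w u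
UGEdge-sym D (inj₁ u→w) = inj₂ u→w
UGEdge-sym D (inj₂ w→u) = inj₁ w→u

UGEdgeAvoiding : Digraph n → Fin n → Rel (Fin n) _
UGEdgeAvoiding D v u w = UGEdge D u w × u ≢ v × w ≢ v

UGEdgeAvoiding? : (D : Digraph n) (v : Fin n) → Decidable (UGEdgeAvoiding D v)
UGEdgeAvoiding? D v u w = UGEdge? D u w ×-dec ¬? (u ≟ v) ×-dec ¬? (w ≟ v)

-- Degrees in balanced bipartite digraphs

module Bipartite {D : Digraph n} {side : Fin n → Bool} {a} (bal : BalancedBipartite D side a) where

  arc⇒side≢ : ∀ {x y} → x ⟶[ D ] y → side x ≢ side y
  arc⇒side≢ = proj₁ bal _ _

  UGEdge⇒side≢ : ∀ {x y} → UGEdge D x y → side x ≢ side y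
  UGEdge⇒side≢ (inj₁ x→y) = arc⇒side≢ x→y
  UGEdge⇒side≢ (inj₂ y→x) = arc⇒side≢ y→x ∘ sym

  common-out-neighbour⇒side≡ : ∀ {x y z} → x ⟶[ D ] z → y ⟶[ D ] z → side x ≡ side y
  common-out-neighbour⇒side≡ x→z y→z = trans (¬-not (arc⇒side≢ x→z)) (sym (¬-not (arc⇒side≢ y→z)))

  private
    opposite : Bool → Fin n → Bool
    opposite true  z = if side z then false else true
    opposite false z = side z

    count-opposite : ∀ p → count (opposite (side p)) ≡ a
    count-opposite p with side p
    ... | true  = proj₁ (proj₂ bal)
    ... | false = proj₂ (proj₂ bal)

    opposite-true : ∀ p z → side z ≢ side p → opposite (side p) z ≡ true
    opposite-true p z side≢ with side p
    ... | true  = subst (λ b → (if b then false else true) ≡ true) (sym (¬-not side≢)) refl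
    ... | false = ¬-not side≢

  outdeg≤ : ∀ p → outdeg D p ≤ a
  outdeg≤ p = subst (_ ≤_) (count-opposite p)
    (count-mono _ _ λ z p→z → opposite-true p z (arc⇒side≢ p→z ∘ sym))

  outdeg< : ∀ p q → side q ≢ side p → ¬ p ⟶[ D ] q → outdeg D p < a
  outdeg< p q side≢ p↛q = subst (_ <_) (count-opposite p)
    (count-mono-< _ _ (λ z p→z → opposite-true p z (arc⇒side≢ p→z ∘ sym))
                  q (opposite-true p q side≢) (¬-not p↛q))

  indeg< : ∀ p q → side q ≢ side p → ¬ q ⟶[ D ] p → indeg D p < a
  indeg< p q side≢ q↛p = subst (_ <_) (count-opposite p)
    (count-mono-< _ _ (λ z z→p → opposite-true p z (arc⇒side≢ z→p))
                  q (opposite-true p q side≢) (¬-not q↛p))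

  Big : Fin n → Set
  Big p = (a + a) ∸ 1 ≤ deg D p

  -- A vertex missing some vertex of the other side has out- and in-degree at most a - 1.
  Big⇒UGEdge : ∀ {p q} → Big p → side q ≢ side p → UGEdge D p q
  Big⇒UGEdge {p} {q} big side≢ with UGEdge? D p q
  ... | yes p~q = p~q
  ... | no  p≁q = ⊥-elim (<⇒≱ (deg< (outdeg< p q side≢ (p≁q ∘ inj₁)) (indeg< p q side≢ (p≁q ∘ inj₂))) big)
    where
      deg< : ∀ {o i} → suc o ≤ a → suc i ≤ a → o + i < (a + a) ∸ 1
      deg< {o} {i} o<a i<a =
        ∸-monoˡ-≤ 1 (subst (_≤ a + a) (cong suc (+-suc o i)) (+-mono-≤ o<a i<a))

  Big⇒3≤indeg : 4 ≤ a → ∀ {p} → Big p → 3 ≤ indeg D p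
  Big⇒3≤indeg 4≤a {p} big = ≤-trans (∸-monoˡ-≤ 1 4≤a) (+-cancelˡ-≤ a _ _ a+a-1≤a+indeg)
    where
      a+a-1≤a+indeg : a + (a ∸ 1) ≤ a + indeg D p
      a+a-1≤a+indeg = ≤-trans (≤-reflexive (sym (+-∸-assoc a (≤-trans (s≤s z≤n) 4≤a))))
                              (≤-trans big (+-monoˡ-≤ (indeg D p) (outdeg≤ p)))

-- Cut vertices

module _ {a} {D : Digraph (a + a)} {side} (bal : BalancedBipartite D side a) (4≤a : 4 ≤ a)
         (strong : StronglyConnected D)
         (dominating : ∀ x y → DominatingPair D x y → (a + a) ∸ 1 ≤ deg D x ⊔ deg D y) where

  open Bipartite {D = D} {side} {a} bal

  private
    V = Fin (a + a)

  arc⇒≢ : ∀ {x y} → x ⟶[ D ] y → x ≢ y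
  arc⇒≢ {x} x→y refl with () ← trans (sym (loopless D x)) x→y

  dominating⇒Big : ∀ {x y} → DominatingPair D x y → Big x ⊎ Big y
  dominating⇒Big {x} {y} pair with ⊔-sel (deg D x) (deg D y)
  ... | inj₁ ⊔≡x = inj₁ (subst (_ ≤_) ⊔≡x (dominating x y pair))
  ... | inj₂ ⊔≡y = inj₂ (subst (_ ≤_) ⊔≡y (dominating x y pair))

  Closed : V → Pred V ℓ₁ → Set ℓ₁
  Closed v A = ∀ {u w} → A u → UGEdge D u w → w ≢ v → A w

  exit-via : ∀ {v x y} {A : Pred V ℓ₁} → Closed v A → A x → ¬ A y → Star _⟶[ D ]_ x y →
             ∃[ p ] A p × p ⟶[ D ] v
  exit-via closed Ax ¬Ay ε = ⊥-elim (¬Ay Ax)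
  exit-via {v = v} {x} closed Ax ¬Ay (_◅_ {j = z} x→z z⇝y) with z ≟ v
  ... | yes refl = x , Ax , x→z
  ... | no  z≢v  = exit-via closed (closed Ax (inj₁ x→z) z≢v) ¬Ay z⇝y

  cut-in-neighbour-¬Big : ∀ {v p q} {A : Pred V ℓ₁} → Closed v A → A p → ¬ A q →
                          p ⟶[ D ] v → q ⟶[ D ] v → ¬ Big p
  cut-in-neighbour-¬Big {v = v} {p} {q} closed Ap ¬Aq p→v q→v big
    with s₁ , s₁→p , s₁∉ ← count-avoid (λ s → arc D s p) (v ∷ λ _ → v) (Big⇒3≤indeg 4≤a big)
    with s₂ , s₂→p , s₂∉ ← count-avoid (λ s → arc D s p) (v ∷ λ _ → s₁) (Big⇒3≤indeg 4≤a big)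
    = [ ¬Big s₁→p (s₁∉ zero ∘ sym) , ¬Big s₂→p (s₂∉ zero ∘ sym) ]′
        (dominating⇒Big (s₂∉ (suc zero) , p , s₁→p , s₂→p))
    where
      side-p≡side-q : side p ≡ side q
      side-p≡side-q = common-out-neighbour⇒side≡ p→v q→v
      q-isolated : ∀ {r} → UGEdge D q r → r ≡ v
      q-isolated {r} q~r with r ≟ v
      ... | yes r≡v = r≡v
      ... | no  r≢v = ⊥-elim (¬Aq (closed Ar (UGEdge-sym D q~r) (arc⇒≢ q→v)))
        where
          Ar = closed Ap (Big⇒UGEdge big (subst (side r ≢_) (sym side-p≡side-q)
                                                   (UGEdge⇒side≢ q~r ∘ sym))) r≢v
      ¬Big : ∀ {s} → s ⟶[ D ] p → s ≢ v → ¬ Big s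
      ¬Big {s} s→p s≢v big-s = s≢v (q-isolated (UGEdge-sym D (Big⇒UGEdge big-s side-q≢side-s)))
        where side-q≢side-s = subst (_≢ side s) side-p≡side-q (arc⇒side≢ s→p ∘ sym)

  Component : V → V → Pred V _
  Component v x = Star (UGEdgeAvoiding D v) x

  component-avoids : ∀ {v x y} → x ≢ v → Component v x y → y ≢ v
  component-avoids x≢v ε                   = x≢v
  component-avoids _   ((_ , _ , z≢v) ◅ w) = component-avoids z≢v w

  component-closed : ∀ {v x} → x ≢ v → Closed v (Component v x)
  component-closed x≢v x⇝u u~w w≢v = x⇝u ◅◅ (u~w , component-avoids x≢v x⇝u , w≢v) ◅ ε

  complement-closed : ∀ {v x} → x ≢ v → Closed v (λ z → ¬ Component v x z × z ≢ v)
  complement-closed x≢v (x↛u , u≢v) u~w w≢v =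
    (λ x⇝w → x↛u (component-closed x≢v x⇝w (UGEdge-sym D u~w) u≢v)) , w≢v

  vertex-deleted-connected : ∀ v x y → x ≢ v → y ≢ v → Star (UGEdgeAvoiding D v) x y
  vertex-deleted-connected v x y x≢v y≢v with Star? (UGEdgeAvoiding? D v) x y
  ... | yes x⇝y = x⇝y
  ... | no  x↛y
    with p , x⇝p , p→v ← exit-via (component-closed x≢v) ε x↛y (strong x y)
    with p′ , (x↛p′ , _) , p′→v ← exit-via (complement-closed x≢v) (x↛y , y≢v) (λ (x↛x , _) → x↛x ε)
                                           (strong y x)
    = ⊥-elim ([ cut-in-neighbour-¬Big (component-closed x≢v) x⇝p x↛p′ p→v p′→v
              , cut-in-neighbour-¬Big (complement-closed x≢v) (x↛p′ , arc⇒≢ p′→v) (λ (x↛p , _) → x↛p x⇝p)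
                                      p′→v p→v
              ]′ (dominating⇒Big ((λ { refl → x↛p′ x⇝p }) , v , p→v , p′→v)))

-- Bypasses of cycles

module _ (D : Digraph n) (strong : StronglyConnected D)
         (cutFree : ∀ v x y → x ≢ v → y ≢ v → Star (UGEdgeAvoiding D v) x y)
         {m} (C : Cycle D m) where

  private
    OnC = OnCycle C
    Off = ∁ OnC

  onC? : Relation.Unary.Decidable OnC
  onC? z = any? (λ i → vert C i ≟ z)

  Entry Exit : Fin n → Fin n → Set
  Entry w c = OnC c × ∃[ s ] c ⟶[ D ] s × Star (Through Off _⟶[ D ]_) s w
  Exit  w c = OnC c × Star (Through Off _⟶[ D ]_) w c

  bypass : ∀ {w c₁ c₂} → Off w → Entry w c₁ → Exit w c₂ → c₁ ≢ c₂ → Bypass C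
  bypass {c₁ = c₁} {c₂} w∉C (c₁∈C , s , c₁→s , s⇝w) (c₂∈C , w⇝c₂) c₁≢c₂
    with simplify _≟_ (s⇝w ◅◅ w⇝c₂) | through-source s⇝w w∉C
  ... | ε , _ | s∉C = ⊥-elim (s∉C c₂∈C)
  ... | path@(_ ◅ rest) , simple | _ =
    length rest ,
    record { pv = c₁ ∷ vertex path ; pinj = ∷-injective c₁∉path simple ; pstep = arcs } ,
    (λ c₁≡last → c₁≢c₂ (trans c₁≡last (vertex-last path))) ,
    c₁∈C ,
    subst OnC (sym (vertex-last path)) c₂∈C ,
    λ { zero _ → inj₁ refl ; (suc i) onC → inj₂ (interior i onC) }
    where
      c₁∉path : ∀ i → vertex path i ≢ c₁
      c₁∉path i e with through-vertex path i
      ... | inj₁ last = c₁≢c₂ (trans (sym e) last)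
      ... | inj₂ off  = off (subst OnC (sym e) c₁∈C)
      arcs : ∀ i → (c₁ ∷ vertex path) (inject₁ i) ⟶[ D ] (c₁ ∷ vertex path) (suc i)
      arcs zero    = c₁→s
      arcs (suc i) = proj₁ (vertex-step path i)
      interior : ∀ i → OnC (vertex path i) → vertex path i ≡ vertex path (fromℕ (length path))
      interior i onC with through-vertex path i
      ... | inj₁ last = trans last (sym (vertex-last path))
      ... | inj₂ off  = ⊥-elim (off onC)

  private
    c₀ : Fin n
    c₀ = vert C zero

  entry-exists : ∀ {w} → Off w → ∃ (Entry w)
  entry-exists w∉C with c , s , c∈C , c→s , s⇝w ← lastDeparture onC? (zero , refl) w∉C (strong c₀ _)
    = c , c∈C , s , c→s , s⇝w

  exit-exists : ∀ {w} → Off w → ∃ (Exit w)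
  exit-exists w∉C with c , c∈C , w⇝c ← firstHit onC? w∉C (zero , refl) (strong _ c₀) = c , c∈C , w⇝c

  Pinned : Fin n → Fin n → Set
  Pinned c w = Entry w c ⊎ Exit w c

  entry-from : ∀ {c w} → Off w → Pinned c w → Bypass C ⊎ Entry w c
  entry-from w∉C (inj₁ entry) = inj₂ entry
  entry-from {c} w∉C (inj₂ exit) with c′ , entry ← entry-exists w∉C | c′ ≟ c
  ... | yes refl = inj₂ entry
  ... | no c′≢c  = inj₁ (bypass w∉C entry exit c′≢c)

  exit-to : ∀ {c w} → Off w → Pinned c w → Bypass C ⊎ Exit w c
  exit-to w∉C (inj₂ exit) = inj₂ exit
  exit-to {c} w∉C (inj₁ entry) with c′ , exit ← exit-exists w∉C | c ≟ c′
  ... | yes refl = inj₂ exit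
  ... | no c≢c′  = inj₁ (bypass w∉C entry exit c≢c′)

  advance : ∀ {c w w′} → Off w → Pinned c w → UGEdge D w w′ → w′ ≢ c →
            Bypass C ⊎ (Off w′ × Pinned c w′)
  advance {w′ = w′} w∉C pinned (inj₁ w→w′) w′≢c with entry-from w∉C pinned | onC? w′
  ... | inj₁ b | _ = inj₁ b
  ... | inj₂ entry | yes w′∈C = inj₁ (bypass w∉C entry (w′∈C , (w→w′ , w∉C) ◅ ε) (w′≢c ∘ sym))
  ... | inj₂ (c∈C , s , c→s , s⇝w) | no w′∉C =
    inj₂ (w′∉C , inj₁ (c∈C , s , c→s , s⇝w ◅◅ (w→w′ , w∉C) ◅ ε))
  advance {w′ = w′} w∉C pinned (inj₂ w′→w) w′≢c with exit-to w∉C pinned | onC? w′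
  ... | inj₁ b | _ = inj₁ b
  ... | inj₂ exit | yes w′∈C = inj₁ (bypass w∉C (w′∈C , _ , w′→w , ε) exit w′≢c)
  ... | inj₂ (c∈C , w⇝c) | no w′∉C = inj₂ (w′∉C , inj₂ (c∈C , (w′→w , w′∉C) ◅ w⇝c))

  walk-to-cycle : ∀ {c w t} → Star (UGEdgeAvoiding D c) w t → Off w → Pinned c w → OnC t →
                  Bypass C
  walk-to-cycle ε w∉C _ t∈C = ⊥-elim (w∉C t∈C)
  walk-to-cycle ((e , _ , w′≢c) ◅ rest) w∉C pinned t∈C with advance w∉C pinned e w′≢c
  ... | inj₁ b = b
  ... | inj₂ (w′∉C , pinned′) = walk-to-cycle rest w′∉C pinned′ t∈C

  other-vertex : 2 ≤ m → ∀ c → ∃[ t ] OnC t × t ≢ c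
  other-vertex 2≤m c with c₀ ≟ c
  ... | no c₀≢c = c₀ , (zero , refl) , c₀≢c
  ... | yes refl = vert C (fromℕ (len-1 C)) , (_ , refl) , last≢first
    where
      last≢first : vert C (fromℕ (len-1 C)) ≢ c₀
      last≢first e with len-1 C | len≡ C | inj C e
      ... | suc _ | _    | ()
      ... | zero  | refl | _ = <⇒≱ 2≤m ≤-refl

  off-vertex : m < n → ∃[ u ] Off u
  off-vertex m<n
    with u , _ , u∉C ← count-avoid (λ _ → true) (vert C) (subst₂ _<_ (len≡ C) (sym count-const) m<n)
    = u , λ (i , e) → u∉C i e

  bypass-exists : 2 ≤ m → m < n → Bypass C
  bypass-exists 2≤m m<n
    with u , u∉C ← off-vertex m<n
    with c , exit@(c∈C , _) ← exit-exists u∉C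
    with t , t∈C , t≢c ← other-vertex 2≤m c
    = walk-to-cycle (cutFree c u t (λ { refl → u∉C c∈C }) t≢c) u∉C (inj₂ exit) t∈C

8≤a+a⇒4≤a : ∀ a → 8 ≤ a + a → 4 ≤ a
8≤a+a⇒4≤a (suc (suc (suc (suc _)))) _ = s≤s (s≤s (s≤s (s≤s z≤n)))
8≤a+a⇒4≤a 3 (s≤s (s≤s (s≤s (s≤s (s≤s (s≤s ()))))))
8≤a+a⇒4≤a 2 (s≤s (s≤s (s≤s (s≤s ()))))
8≤a+a⇒4≤a 1 (s≤s (s≤s ()))
8≤a+a⇒4≤a 0 ()

≤∸2⇒< : ∀ {m n} → 0 < n → m ≤ n ∸ 2 → m < n
≤∸2⇒< {n = suc n} _ m≤n∸2 = s≤s (≤-trans m≤n∸2 (m∸n≤m n 1))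

lemma4p2 : (a : ℕ) (D : Digraph (a + a)) (side : Fin (a + a) → Bool) →
    BalancedBipartite D side a →
    8 ≤ a + a →
    StronglyConnected D →
    (∀ x y → DominatingPair D x y → (a + a) ∸ 1 ≤ deg D x ⊔ deg D y) →
    TwoConnectedUG D
    × (∀ (m : ℕ) (C : Cycle D m) → 2 ≤ m → m ≤ (a + a) ∸ 2 → Bypass C)
lemma4p2 a D side bal 8≤a+a strong dominating =
  (2<a+a , (λ x y → Star-map inj₁ (strong x y)) , cut-free) ,
  λ m C 2≤m m≤a+a∸2 → bypass-exists D strong cut-free C 2≤m (≤∸2⇒< (≤-trans (s≤s z≤n) 8≤a+a) m≤a+a∸2)
  where
    2<a+a : 2 < a + a
    2<a+a = ≤-trans (s≤s (s≤s (s≤s z≤n))) 8≤a+a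
    cut-free : ∀ v x y → x ≢ v → y ≢ v → Star (UGEdgeAvoiding D v) x y
    cut-free = vertex-deleted-connected {D = D} {side} bal (8≤a+a⇒4≤a a 8≤a+a) strong dominating
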